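{- Let $\Sigma\cup\{\varphi,\psi\}$ be a countable set of $\mathcal{L}^{2}_{\Theta}$-sentences. If $\Sigma\cup\{\varphi\}\vdash\psi$, then $\Sigma\vdash\varphi\rightarrow\psi$.
   Context: Fix a countable first-order vocabulary of predicate constants $P_0,P_1,\dots$ (with identity). Let $\Theta$ be a countable set of first-order formulas, each written $\theta(\overline{x},\overline{y})$ where $\overline{x}$ is a nonempty tuple of distinguished free variables (its length $l+1$ is the arity of $\theta$) and $\overline{y}$ lists the remaining free variables (parameters). Enumerate $\Theta$ as $\theta^{l+1}_n$ ($n,l\in\omega$), $l+1$ being the arity. The language $\mathcal{L}^{2}_{\Theta}$ is the second-order language over this vocabulary with first-order variables $x_0,x_1,\dots$ and, for each arity $l+1$, countably many second-order variables $V^{l+1}_m$; atomic formulas are the first-order ones together with $V^{l+1}_m(t_1,\dots,t_{l+1})$ and $V_m=V_n$ (same arity); formulas are built with $\neg,\wedge,\forall$ over both sorts (other connectives and $\exists$ defined as usual). For a formula $\chi$, a second-order variable $V^{l+1}_m$ and $n\in\omega$, $\chi^{l+1,m}_n$ is obtained by replacing any expression $V^{l+1}_m(\overline{x})$ (not bound by a quantifier) in $\chi$ by $\theta^{l+1}_n(\overline{x},\overline{y})$ and prefixing the resulting formula with the string of quantifiers $\forall\overline{x}$. Proof system: any complete set of axioms for first-order logic, plus the schemata (A1) $\forall\overline{y}\,\exists V\,\forall\overline{x}\,(V(\overline{x})\leftrightarrow\theta(\overline{x},\overline{y}))$ for each $\theta(\overline{x},\overline{y})\in\Theta$; (A2)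 $\forall V_m,V_n(\forall\overline{x}(V_m(\overline{x})\leftrightarrow V_n(\overline{x}))\leftrightarrow V_m=V_n)$ (same arity); (A3) $\forall V_m,V_n(V_m=V_n\rightarrow(\chi\rightarrow\chi'))$ where $\chi'$ results from $\chi$ by replacing some occurrences of $V_m$ by $V_n$ (same arity); (A4) $\forall V_m\chi\rightarrow\chi(V_m/V_n)$ where $V_n$ is free for $V_m$ in $\chi$ (same arity); (A5) $\forall V_m(\chi\rightarrow\sigma)\rightarrow(\chi\rightarrow\forall V_m\sigma)$ where $V_m$ is not free in $\chi$; (A6) $\forall V^{l+1}_m\chi\rightarrow\chi^{l+1,m}_n$ for all $m,n$; and rules (R1) modus ponens; (R2) from $\chi$ infer $\forall V\chi$ and $\forall x\chi$; (R3) from $\sigma\rightarrow\chi^{l+1,m}_0,\ \sigma\rightarrow\chi^{l+1,m}_1,\dots$ infer $\sigma\rightarrow\forall V^{l+1}_m\chi$. A deduction of $\chi$ from a set $\Gamma$ of sentences is a countable sequence of formulas ending with $\chi$, each member of which is in $\Gamma$, an axiom, or obtained from previous members by one of (R1)–(R3); write $\Gamma\vdash\chi$. -}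

module Defs where

open import Data.Nat using (ℕ; zero; suc; _≟_; _≡ᵇ_)
open import Data.Bool using (Bool; true; false; not; _∧_; if_then_else_)
open import Data.Vec using (Vec; []; _∷_; lookup; toList)
  renaming (map to vmap)
open import Data.Vec.Membership.Propositional using () renaming (_∈_ to _∈v_)
open import Data.Vec.Membership.DecPropositional _≟_ using () renaming (_∈?_ to _∈v?_)
open import Data.Vec.Relation.Binary.Pointwise.Inductive using (Pointwise)
open import Data.List using (List; []; _∷_; _++_; filter; foldr)
open import Data.Fin using (Fin)
open import Data.Product using (_×_)
open import Data.Sum using (_⊎_)
open import Data.Empty using (⊥)
open import Data.Unit using (⊤)
open import Relation.Nullary using (¬_; ¬?; yes; no)
open import Relation.Binary.PropositionalEquality using (_≡_; _≢_; refl)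

-- Syntax of L²_Θ over the vocabulary P₀,P₁,… ; ar i is the arity of Pᵢ.
-- First-order variables xᵢ are named by i : ℕ.
-- Second-order variable V^{l+1}_m is named by the pair (l , m).

data Formula (ar : ℕ → ℕ) : Set where
  rel  : (i : ℕ) → Vec ℕ (ar i) → Formula ar
  eq   : ℕ → ℕ → Formula ar
  app  : (l m : ℕ) → Vec ℕ (suc l) → Formula ar
  veq  : (l m n : ℕ) → Formula ar
  neg  : Formula ar → Formula ar
  and  : Formula ar → Formula ar → Formula ar
  all₁ : ℕ → Formula ar → Formula ar
  all₂ : (l m : ℕ) → Formula ar → Formula ar

module _ {ar : ℕ → ℕ} where

  _⇒_ : Formula ar → Formula ar → Formula ar
  φ ⇒ ψ = neg (and φ (neg ψ))

  _⇔_ : Formula ar → Formula ar → Formula ar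
  φ ⇔ ψ = and (φ ⇒ ψ) (ψ ⇒ φ)

  ex₂ : (l m : ℕ) → Formula ar → Formula ar
  ex₂ l m φ = neg (all₂ l m (neg φ))

  allV : {k : ℕ} → Vec ℕ k → Formula ar → Formula ar
  allV []       φ = φ
  allV (x ∷ xs) φ = all₁ x (allV xs φ)

  allL : List ℕ → Formula ar → Formula ar
  allL xs φ = foldr all₁ φ xs

  Free1 : ℕ → Formula ar → Set
  Free1 x (rel i xs)   = x ∈v xs
  Free1 x (eq a b)     = x ≡ a ⊎ x ≡ b
  Free1 x (app l m xs) = x ∈v xs
  Free1 x (veq l m n)  = ⊥
  Free1 x (neg φ)      = Free1 x φ
  Free1 x (and φ ψ)    = Free1 x φ ⊎ Free1 x ψ
  Free1 x (all₁ z φ)   = x ≢ z × Free1 x φ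
  Free1 x (all₂ l m φ) = Free1 x φ

  Free2 : (l m : ℕ) → Formula ar → Set
  Free2 l m (rel i xs)     = ⊥
  Free2 l m (eq a b)       = ⊥
  Free2 l m (app l' m' xs) = l' ≡ l × m' ≡ m
  Free2 l m (veq l' a b)   = l' ≡ l × (a ≡ m ⊎ b ≡ m)
  Free2 l m (neg φ)        = Free2 l m φ
  Free2 l m (and φ ψ)      = Free2 l m φ ⊎ Free2 l m ψ
  Free2 l m (all₁ z φ)     = Free2 l m φ
  Free2 l m (all₂ l' m' φ) = ¬ (l' ≡ l × m' ≡ m) × Free2 l m φ

  Sentence : Formula ar → Set
  Sentence φ = ((x : ℕ) → ¬ Free1 x φ) × ((l m : ℕ) → ¬ Free2 l m φ)

  fv : Formula ar → List ℕ
  fv (rel i xs)   = toList xs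
  fv (eq a b)     = a ∷ b ∷ []
  fv (app l m xs) = toList xs
  fv (veq l m n)  = []
  fv (neg φ)      = fv φ
  fv (and φ ψ)    = fv φ ++ fv ψ
  fv (all₁ z φ)   = filter (λ v → ¬? (v ≟ z)) (fv φ)
  fv (all₂ l m φ) = fv φ

  FirstOrder : Formula ar → Set
  FirstOrder (rel i xs)   = ⊤
  FirstOrder (eq a b)     = ⊤
  FirstOrder (app l m xs) = ⊥
  FirstOrder (veq l m n)  = ⊥
  FirstOrder (neg φ)      = FirstOrder φ
  FirstOrder (and φ ψ)    = FirstOrder φ × FirstOrder ψ
  FirstOrder (all₁ z φ)   = FirstOrder φ
  FirstOrder (all₂ l m φ) = ⊥

  ren : (ℕ → ℕ) → Formula ar → Formula ar
  ren σ (rel i xs)   = rel i (vmap σ xs)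
  ren σ (eq a b)     = eq (σ a) (σ b)
  ren σ (app l m xs) = app l m (vmap σ xs)
  ren σ (veq l m n)  = veq l m n
  ren σ (neg φ)      = neg (ren σ φ)
  ren σ (and φ ψ)    = and (ren σ φ) (ren σ ψ)
  ren σ (all₁ z φ)   = all₁ z (ren (λ v → if v ≡ᵇ z then z else σ v) φ)
  ren σ (all₂ l m φ) = all₂ l m (ren σ φ)

  subst1 : (y x : ℕ) → Formula ar → Formula ar
  subst1 y x = ren (λ v → if v ≡ᵇ x then y else v)

  SubstOK1 : (y x : ℕ) → Formula ar → Set
  SubstOK1 y x (rel i xs)   = ⊤
  SubstOK1 y x (eq a b)     = ⊤
  SubstOK1 y x (app l m xs) = ⊤
  SubstOK1 y x (veq l m n)  = ⊤
  SubstOK1 y x (neg φ)      = SubstOK1 y x φ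
  SubstOK1 y x (and φ ψ)    = SubstOK1 y x φ × SubstOK1 y x ψ
  SubstOK1 y x (all₁ z φ)   = ¬ Free1 x (all₁ z φ) ⊎ (z ≢ y × SubstOK1 y x φ)
  SubstOK1 y x (all₂ l m φ) = SubstOK1 y x φ

  subst2 : (l m n : ℕ) → Formula ar → Formula ar
  subst2 l m n (rel i xs)     = rel i xs
  subst2 l m n (eq a b)       = eq a b
  subst2 l m n (app l' m' xs) = if (l' ≡ᵇ l) ∧ (m' ≡ᵇ m) then app l' n xs else app l' m' xs
  subst2 l m n (veq l' a b)   =
    if l' ≡ᵇ l then veq l' (if a ≡ᵇ m then n else a) (if b ≡ᵇ m then n else b)
               else veq l' a b
  subst2 l m n (neg φ)        = neg (subst2 l m n φ)
  subst2 l m n (and φ ψ)      = and (subst2 l m n φ) (subst2 l m n ψ)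
  subst2 l m n (all₁ z φ)     = all₁ z (subst2 l m n φ)
  subst2 l m n (all₂ l' k φ)  =
    if (l' ≡ᵇ l) ∧ (k ≡ᵇ m) then all₂ l' k φ else all₂ l' k (subst2 l m n φ)

  FreeFor2 : (l m n : ℕ) → Formula ar → Set
  FreeFor2 l m n (rel i xs)    = ⊤
  FreeFor2 l m n (eq a b)      = ⊤
  FreeFor2 l m n (app _ _ _)   = ⊤
  FreeFor2 l m n (veq _ _ _)   = ⊤
  FreeFor2 l m n (neg φ)       = FreeFor2 l m n φ
  FreeFor2 l m n (and φ ψ)     = FreeFor2 l m n φ × FreeFor2 l m n ψ
  FreeFor2 l m n (all₁ z φ)    = FreeFor2 l m n φ
  FreeFor2 l m n (all₂ l' k φ) =
    ¬ Free2 l m (all₂ l' k φ) ⊎ (¬ (l' ≡ l × k ≡ n) × FreeFor2 l m n φ)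

  data Repl2 (l m n : ℕ) : Formula ar → Formula ar → Set where
    same  : ∀ φ → Repl2 l m n φ φ
    r-app : ∀ xs → Repl2 l m n (app l m xs) (app l n xs)
    r-veq : ∀ a b a' b' → (a' ≡ a ⊎ (a ≡ m × a' ≡ n)) → (b' ≡ b ⊎ (b ≡ m × b' ≡ n)) →
            Repl2 l m n (veq l a b) (veq l a' b')
    r-neg : ∀ {φ φ'} → Repl2 l m n φ φ' → Repl2 l m n (neg φ) (neg φ')
    r-and : ∀ {φ φ' ψ ψ'} → Repl2 l m n φ φ' → Repl2 l m n ψ ψ' →
            Repl2 l m n (and φ ψ) (and φ' ψ')
    r-all₁ : ∀ z {φ φ'} → Repl2 l m n φ φ' → Repl2 l m n (all₁ z φ) (all₁ z φ')
    r-all₂ : ∀ l' k {φ φ'} → ¬ (l' ≡ l × (k ≡ m ⊎ k ≡ n)) → Repl2 l m n φ φ' →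
             Repl2 l m n (all₂ l' k φ) (all₂ l' k φ')

  RV : (x y : ℕ) → ℕ → ℕ → Set
  RV x y a a' = a' ≡ a ⊎ (a ≡ x × a' ≡ y)

  data AtomRepl (x y : ℕ) : Formula ar → Formula ar → Set where
    ar-rel : ∀ i {xs xs'} → Pointwise (RV x y) xs xs' → AtomRepl x y (rel i xs) (rel i xs')
    ar-eq  : ∀ {a b a' b'} → RV x y a a' → RV x y b b' → AtomRepl x y (eq a b) (eq a' b')
    ar-app : ∀ l m {xs xs'} → Pointwise (RV x y) xs xs' → AtomRepl x y (app l m xs) (app l m xs')

  eval : (Formula ar → Bool) → Formula ar → Bool
  eval v (neg φ)   = not (eval v φ)
  eval v (and φ ψ) = eval v φ ∧ eval v ψ
  eval v φ         = v φ

  Taut : Formula ar → Set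
  Taut φ = (v : Formula ar → Bool) → eval v φ ≡ true

-- The countable set Θ, enumerated as θ^{l+1}_n, with distinguished
-- variables dv l n = x̄ (a tuple of l+1 distinct variables).

record Theta (ar : ℕ → ℕ) : Set where
  field
    θ           : (l n : ℕ) → Formula ar
    dv          : (l n : ℕ) → Vec ℕ (suc l)
    dv-distinct : (l n : ℕ) (i j : Fin (suc l)) → lookup (dv l n) i ≡ lookup (dv l n) j → i ≡ j
    θ-fo        : (l n : ℕ) → FirstOrder (θ l n)

module _ {ar : ℕ → ℕ} (Θ : Theta ar) where
  open Theta Θ

  plug : {k : ℕ} → Vec ℕ k → Vec ℕ k → ℕ → ℕ
  plug [] [] v = v
  plug (x ∷ xs) (t ∷ ts) v = if v ≡ᵇ x then t else plug xs ts v

  replV : (l m : ℕ) → Formula ar → Vec ℕ (suc l) → Formula ar → Formula ar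
  replV l m th xs (rel i ys) = rel i ys
  replV l m th xs (eq a b) = eq a b
  replV l m th xs (app l' m' ts) with l' ≟ l | m' ≟ m
  ... | yes refl | yes refl = ren (plug xs ts) th
  ... | _ | _ = app l' m' ts
  replV l m th xs (veq l' a b) = veq l' a b
  replV l m th xs (neg φ) = neg (replV l m th xs φ)
  replV l m th xs (and φ ψ) = and (replV l m th xs φ) (replV l m th xs ψ)
  replV l m th xs (all₁ z φ) = all₁ z (replV l m th xs φ)
  replV l m th xs (all₂ l' k φ) =
    if (l' ≡ᵇ l) ∧ (k ≡ᵇ m) then all₂ l' k φ else all₂ l' k (replV l m th xs φ)

  inst : (l m n : ℕ) → Formula ar → Formula ar
  inst l m n χ = allV (dv l n) (replV l m (θ l n) (dv l n) χ)

  A1 : (l n m : ℕ) → Formula ar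
  A1 l n m =
    allL (filter (λ v → ¬? (v ∈v? dv l n)) (fv (θ l n)))
      (ex₂ l m (allV (dv l n) (app l m (dv l n) ⇔ θ l n)))

  Distinct : {k : ℕ} → Vec ℕ k → Set
  Distinct {k} xs = (i j : Fin k) → lookup xs i ≡ lookup xs j → i ≡ j

  data Axiom : Formula ar → Set where
    -- first-order logic (Enderton-style complete Hilbert system; Gen is rule R2)
    taut : ∀ φ → Taut φ → Axiom φ
    q-inst : ∀ x y φ → SubstOK1 y x φ → Axiom (all₁ x φ ⇒ subst1 y x φ)
    q-dist : ∀ x φ ψ → Axiom (all₁ x (φ ⇒ ψ) ⇒ (all₁ x φ ⇒ all₁ x ψ))
    q-vac  : ∀ x φ → ¬ Free1 x φ → Axiom (φ ⇒ all₁ x φ)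
    q-refl : ∀ x → Axiom (eq x x)
    q-eq   : ∀ x y α α' → AtomRepl x y α α' → Axiom (eq x y ⇒ (α ⇒ α'))
    a1 : ∀ l n m → Axiom (A1 l n m)
    a2 : ∀ l m k (xs : Vec ℕ (suc l)) → Distinct xs →
         Axiom (all₂ l m (all₂ l k (allV xs (app l m xs ⇔ app l k xs) ⇔ veq l m k)))
    a3 : ∀ l m k χ χ' → Repl2 l m k χ χ' →
         Axiom (all₂ l m (all₂ l k (veq l m k ⇒ (χ ⇒ χ'))))
    a4 : ∀ l m k χ → FreeFor2 l m k χ → Axiom (all₂ l m χ ⇒ subst2 l m k χ)
    a5 : ∀ l m χ σ → ¬ Free2 l m χ → Axiom (all₂ l m (χ ⇒ σ) ⇒ (χ ⇒ all₂ l m σ))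
    a6 : ∀ l m n χ → Axiom (all₂ l m χ ⇒ inst l m n χ)

  -- Γ ⊢ χ : well-founded (possibly infinitary) deduction trees,
  -- equivalent to countable well-ordered deduction sequences.
  data _⊢_ (Γ : Formula ar → Set) : Formula ar → Set where
    hyp  : ∀ {χ} → Γ χ → Γ ⊢ χ
    ax   : ∀ {χ} → Axiom χ → Γ ⊢ χ
    mp   : ∀ {χ σ} → Γ ⊢ χ → Γ ⊢ (χ ⇒ σ) → Γ ⊢ σ
    gen₁ : ∀ x {χ} → Γ ⊢ χ → Γ ⊢ all₁ x χ
    gen₂ : ∀ l m {χ} → Γ ⊢ χ → Γ ⊢ all₂ l m χ
    ω-rule : ∀ l m σ χ → ((n : ℕ) → Γ ⊢ (σ ⇒ inst l m n χ)) →
             Γ ⊢ (σ ⇒ all₂ l m χ)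

_∪｛_｝ : {ar : ℕ → ℕ} → (Formula ar → Set) → Formula ar → Formula ar → Set
(Γ ∪｛ φ ｝) χ = Γ χ ⊎ χ ≡ φ

{-# OPTIONS --safe #-}
-- Hypotheses, axioms and modus ponens are
-- handled propositionally as for first-order logic. Since φ is a sentence, a
-- generalisation step commutes with φ ⇒ _ by the vacuous-quantifier axiom
-- (first order) or by (A5) (second order), and the ω-rule (R3) with side
-- formula σ is replayed with side formula φ ∧ σ.
module Submission where

open import Defs
open import Data.Nat using (ℕ)
open import Data.Bool using (Bool; true; false; not; _∧_)
open import Data.Sum using (inj₁; inj₂)
open import Data.Product using (proj₁; proj₂)
open import Relation.Nullary using (¬_)
open import Relation.Binary.PropositionalEquality using (_≡_; refl)

infixr 5 _⇒ᵇ_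
_⇒ᵇ_ : Bool → Bool → Bool
x ⇒ᵇ y = not (x ∧ not y)

module _ {ar : ℕ → ℕ} where

  K-taut : (a b : Formula ar) → Taut (a ⇒ (b ⇒ a))
  K-taut a b v = law (eval v a) (eval v b)
    where
    law : ∀ x y → (x ⇒ᵇ y ⇒ᵇ x) ≡ true
    law true  true  = refl
    law true  false = refl
    law false _     = refl

  I-taut : (a : Formula ar) → Taut (a ⇒ a)
  I-taut a v = law (eval v a)
    where
    law : ∀ x → (x ⇒ᵇ x) ≡ true
    law true  = refl
    law false = refl

  S-taut : (a b c : Formula ar) → Taut ((a ⇒ b) ⇒ ((a ⇒ (b ⇒ c)) ⇒ (a ⇒ c)))
  S-taut a b c v = law (eval v a) (eval v b) (eval v c)
    where
    law : ∀ x y z → ((x ⇒ᵇ y) ⇒ᵇ (x ⇒ᵇ y ⇒ᵇ z) ⇒ᵇ x ⇒ᵇ z) ≡ true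
    law true  true  true  = refl
    law true  true  false = refl
    law true  false _     = refl
    law false _     _     = refl

  trans-taut : (a b c : Formula ar) → Taut ((a ⇒ b) ⇒ ((b ⇒ c) ⇒ (a ⇒ c)))
  trans-taut a b c v = law (eval v a) (eval v b) (eval v c)
    where
    law : ∀ x y z → ((x ⇒ᵇ y) ⇒ᵇ (y ⇒ᵇ z) ⇒ᵇ x ⇒ᵇ z) ≡ true
    law true  true  true  = refl
    law true  true  false = refl
    law true  false _     = refl
    law false true  true  = refl
    law false true  false = refl
    law false false _     = refl

  uncurry-taut : (a b c : Formula ar) → Taut ((a ⇒ (b ⇒ c)) ⇒ (and a b ⇒ c))
  uncurry-taut a b c v = law (eval v a) (eval v b) (eval v c)
    where
    law : ∀ x y z → ((x ⇒ᵇ y ⇒ᵇ z) ⇒ᵇ (x ∧ y) ⇒ᵇ z) ≡ true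
    law true  true  true  = refl
    law true  true  false = refl
    law true  false _     = refl
    law false _     _     = refl

  curry-taut : (a b c : Formula ar) → Taut ((and a b ⇒ c) ⇒ (a ⇒ (b ⇒ c)))
  curry-taut a b c v = law (eval v a) (eval v b) (eval v c)
    where
    law : ∀ x y z → (((x ∧ y) ⇒ᵇ z) ⇒ᵇ x ⇒ᵇ y ⇒ᵇ z) ≡ true
    law true  true  true  = refl
    law true  true  false = refl
    law true  false _     = refl
    law false _     _     = refl

module _ {ar : ℕ → ℕ} (Θ : Theta ar) {Γ : Formula ar → Set} where

  private
    infix 4 ⊢_
    ⊢_ : Formula ar → Set
    ⊢ χ = _⊢_ Θ Γ χ

  tautology : ∀ {χ} → Taut χ → ⊢ χ
  tautology t = ax (taut _ t)

  weaken : ∀ {χ} φ → ⊢ χ → ⊢ φ ⇒ χ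
  weaken {χ} φ d = mp d (tautology (K-taut χ φ))

  mp-under : ∀ {φ χ σ} → ⊢ φ ⇒ χ → ⊢ φ ⇒ (χ ⇒ σ) → ⊢ φ ⇒ σ
  mp-under {φ} {χ} {σ} d e = mp e (mp d (tautology (S-taut φ χ σ)))

  ⇒-trans : ∀ {a b c} → ⊢ a ⇒ b → ⊢ b ⇒ c → ⊢ a ⇒ c
  ⇒-trans {a} {b} {c} d e = mp e (mp d (tautology (trans-taut a b c)))

  uncurry : ∀ {a b c} → ⊢ a ⇒ (b ⇒ c) → ⊢ and a b ⇒ c
  uncurry {a} {b} {c} d = mp d (tautology (uncurry-taut a b c))

  curry : ∀ {a b c} → ⊢ and a b ⇒ c → ⊢ a ⇒ (b ⇒ c)
  curry {a} {b} {c} d = mp d (tautology (curry-taut a b c))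

  gen₁-under : ∀ {φ χ} x → ¬ Free1 x φ → ⊢ φ ⇒ χ → ⊢ φ ⇒ all₁ x χ
  gen₁-under {φ} {χ} x x∉φ d =
    ⇒-trans (ax (q-vac x φ x∉φ)) (mp (gen₁ x d) (ax (q-dist x φ χ)))

  gen₂-under : ∀ {φ χ} l m → ¬ Free2 l m φ → ⊢ φ ⇒ χ → ⊢ φ ⇒ all₂ l m χ
  gen₂-under {φ} {χ} l m V∉φ d = mp (gen₂ l m d) (ax (a5 l m φ χ V∉φ))

  ω-rule-under : ∀ {φ} l m σ χ → ((n : ℕ) → ⊢ φ ⇒ (σ ⇒ inst Θ l m n χ)) →
                 ⊢ φ ⇒ (σ ⇒ all₂ l m χ)
  ω-rule-under {φ} l m σ χ ds = curry (ω-rule l m (and φ σ) χ (λ n → uncurry (ds n)))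

deduction-theorem : ∀ {ar} (Θ : Theta ar) {Γ : Formula ar → Set} {φ ψ : Formula ar} →
                    Sentence φ → _⊢_ Θ (Γ ∪｛ φ ｝) ψ → _⊢_ Θ Γ (φ ⇒ ψ)
deduction-theorem Θ {Γ} {φ} sφ = go
  where
  go : ∀ {ψ} → _⊢_ Θ (Γ ∪｛ φ ｝) ψ → _⊢_ Θ Γ (φ ⇒ ψ)
  go (hyp (inj₁ γ))      = weaken Θ φ (hyp γ)
  go (hyp (inj₂ refl))   = tautology Θ (I-taut φ)
  go (ax a)              = weaken Θ φ (ax a)
  go (mp d e)            = mp-under Θ (go d) (go e)
  go (gen₁ x d)          = gen₁-under Θ x (proj₁ sφ x) (go d)
  go (gen₂ l m d)        = gen₂-under Θ l m (proj₂ sφ l m) (go d)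
  go (ω-rule l m σ χ ds) = ω-rule-under Θ l m σ χ (λ n → go (ds n))

-- Only φ needs to be a sentence.
mainTheorem6 : (ar : ℕ → ℕ) (Θ : Theta ar) (Γ : Formula ar → Set) (φ ψ : Formula ar) →
    ((χ : Formula ar) → Γ χ → Sentence χ) → Sentence φ → Sentence ψ →
    _⊢_ Θ (Γ ∪｛ φ ｝) ψ → _⊢_ Θ Γ (φ ⇒ ψ)
mainTheorem6 ar Θ Γ φ ψ _ sφ _ = deduction-theorem Θ sφ
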